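{- Let $\mathcal I = X_1,X_2,\dots,X_l$ be an $I$-ordering in which $X_i=X_{i+1}$ for some $i\in\{1,\dots,l-1\}$, and let $\mathcal I'$ be the $I$-ordering obtained from $\mathcal I$ by deleting $X_{i+1}$. Then $\mathcal I$ is equivalent to $\mathcal I'$.
   Context: $I$ is the vertex set of a graph $H$ (in the paper $H=G_1[I]=G_2[I]$ for two interval graphs $G_1,G_2$ with $V(G_1)\cap V(G_2)=I$). Cliques may be empty. An $I$-ordering is a clique ordering of $H$: a finite sequence of (possibly empty) cliques of $H$ containing every maximal clique of $H$ such that for every vertex $v$ the indices of cliques containing $v$ are consecutive. For a sequence $Q_1,\dots,Q_l$ of cliques, with $Q_0=Q_{l+1}=\emptyset$, a subclique insertion inserts a clique $Q'$ of $H$ between $Q_i$ and $Q_{i+1}$ ($0\le i\le l$) where $Q'\supseteq Q_i\cap Q_{i+1}$ and $Q'\subseteq Q_i$ or $Q'\subseteq Q_{i+1}$; an extension is obtained by finitely many subclique insertions. Two $I$-orderings are compatible if both extend to a common $I$-ordering. Two $I$-orderings $\mathcal I_1,\mathcal I_2$ are equivalent if for every $I$-ordering $\mathcal I''$, $\mathcal I_1$ is compatible with $\mathcal I''$ if and only if $\mathcal I_2$ is compatible with $\mathcal I''$. -}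

module Defs where

open import Level using (0ℓ)
open import Data.Nat using (ℕ)
open import Data.Fin using (Fin; _≤_)
open import Data.List using (List; []; _∷_; _++_; length; lookup)
open import Data.List.Membership.Propositional using () renaming (_∈_ to _∈L_)
open import Data.Product using (Σ; _×_; ∃; ∃-syntax)
open import Data.Sum using (_⊎_)
open import Data.Empty using (⊥)
open import Relation.Nullary using (¬_)
open import Relation.Binary.PropositionalEquality using (_≡_; _≢_)
open import Relation.Binary.Construct.Closure.ReflexiveTransitive using (Star)
open import Function.Bundles using (_⇔_)
open import Data.Fin.Subset as S using (Subset; _∈_; _⊆_; _∩_)

record Graph (n : ℕ) : Set₁ where
  field
    Adj    : Fin n → Fin n → Set
    sym    : ∀ {u v} → Adj u v → Adj v u
    irrefl : ∀ {u} → ¬ Adj u u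

module _ {n : ℕ} (H : Graph n) where
  open Graph H

  IsClique : Subset n → Set
  IsClique Q = ∀ u v → u ∈ Q → v ∈ Q → u ≢ v → Adj u v

  IsMaximalClique : Subset n → Set
  IsMaximalClique Q = IsClique Q × (∀ Q' → IsClique Q' → Q ⊆ Q' → Q' ⊆ Q)

  record IOrdering (L : List (Subset n)) : Set where
    field
      cliques     : ∀ Q → Q ∈L L → IsClique Q
      hasMaximal  : ∀ Q → IsMaximalClique Q → Q ∈L L
      consecutive : ∀ (v : Fin n) (i j k : Fin (length L)) → i ≤ j → j ≤ k →
                    v ∈ lookup L i → v ∈ lookup L k → v ∈ lookup L j

  -- last element of a list, or ∅ (convention Q₀ = ∅)
  lastOr∅ : List (Subset n) → Subset n
  lastOr∅ []           = S.⊥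
  lastOr∅ (x ∷ [])     = x
  lastOr∅ (x ∷ y ∷ xs) = lastOr∅ (y ∷ xs)

  -- first element of a list, or ∅ (convention Q_{l+1} = ∅)
  headOr∅ : List (Subset n) → Subset n
  headOr∅ []       = S.⊥
  headOr∅ (x ∷ xs) = x

  -- One subclique insertion: insert Q' between Q_i = lastOr∅ as and
  -- Q_{i+1} = headOr∅ bs.
  data SubcliqueInsertion : List (Subset n) → List (Subset n) → Set where
    insert : ∀ as bs Q' → IsClique Q' →
             (lastOr∅ as ∩ headOr∅ bs) ⊆ Q' →
             (Q' ⊆ lastOr∅ as ⊎ Q' ⊆ headOr∅ bs) →
             SubcliqueInsertion (as ++ bs) (as ++ Q' ∷ bs)

  Extends : List (Subset n) → List (Subset n) → Set
  Extends = Star SubcliqueInsertion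

  Compatible : List (Subset n) → List (Subset n) → Set
  Compatible L₁ L₂ = ∃[ J ] (IOrdering J × Extends L₁ J × Extends L₂ J)

  Equivalent : List (Subset n) → List (Subset n) → Set
  Equivalent L₁ L₂ = ∀ L'' → IOrdering L'' → (Compatible L₁ L'' ⇔ Compatible L₂ L'')

module Submission where

open import Defs
open import Data.Nat using (ℕ; z≤n; s≤s)
open import Data.Fin using (Fin; zero; suc; _≤_)
open import Data.Fin.Subset using (Subset; _∈_; _⊆_; _∩_)
open import Data.Fin.Subset.Properties using (p∩q⊆q; ⊆-refl)
open import Data.List using (List; []; _∷_; _++_; length; lookup)
open import Data.List.Relation.Unary.Any using (here; there; index)
open import Data.List.Relation.Unary.Any.Properties using (lookup-index)
open import Data.List.Membership.Propositional using () renaming (_∈_ to _∈L_)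
open import Data.List.Membership.Propositional.Properties using (∈-lookup; ∈-++⁺ʳ)
open import Data.Product using (_×_; _,_; ∃-syntax; ∃₂)
open import Data.Sum using (_⊎_; inj₂)
open import Relation.Binary.Core using (_Preserves_⟶_)
open import Relation.Binary.PropositionalEquality using (_≡_; refl; sym; subst)
open import Relation.Binary.Construct.Closure.ReflexiveTransitive using (ε; _◅_; _◅◅_)
open import Function.Bundles using (mk⇔)

-- Re-inserting the deleted copy of X is a subclique insertion, so the shorter
-- ordering extends to the longer one and hence to all of its extensions.
-- Conversely, every subclique insertion into the shorter ordering can be
-- replayed on the longer one without changing the neighbours of the inserted
-- clique; so a common extension J of the shorter ordering and I'' becomes one,
-- J with X doubled, of the longer ordering and I''.

module _ {A : Set} where

  data Duplicate (x : A) : List A → List A → Set where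
    here  : ∀ zs → Duplicate x (x ∷ zs) (x ∷ x ∷ zs)
    there : ∀ {xs ys} z → Duplicate x xs ys → Duplicate x (z ∷ xs) (z ∷ ys)

  module _ {x : A} where

    Duplicate-++⁺ˡ : ∀ {xs ys} zs → Duplicate x xs ys → Duplicate x (zs ++ xs) (zs ++ ys)
    Duplicate-++⁺ˡ []       d = d
    Duplicate-++⁺ˡ (z ∷ zs) d = there z (Duplicate-++⁺ˡ zs d)

    Duplicate-++⁺ʳ : ∀ {xs ys} zs → Duplicate x xs ys → Duplicate x (xs ++ zs) (ys ++ zs)
    Duplicate-++⁺ʳ zs (here ws)   = here (ws ++ zs)
    Duplicate-++⁺ʳ zs (there z d) = there z (Duplicate-++⁺ʳ zs d)

    duplicate-at : ∀ xs zs → Duplicate x (xs ++ x ∷ zs) (xs ++ x ∷ x ∷ zs)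
    duplicate-at xs zs = Duplicate-++⁺ˡ xs (here zs)

    Duplicate⇒++ : ∀ {xs ys} → Duplicate x xs ys →
                   ∃₂ λ us ws → xs ≡ us ++ x ∷ ws × ys ≡ us ++ x ∷ x ∷ ws
    Duplicate⇒++ (here zs) = [] , zs , refl , refl
    Duplicate⇒++ (there z d) with Duplicate⇒++ d
    ... | us , ws , refl , refl = z ∷ us , ws , refl , refl

    data DuplicateSplit (us ws : List A) : List A → Set where
      inRight : ∀ {ws'} → Duplicate x ws ws' → DuplicateSplit us ws (us ++ ws')
      inLeft  : ∀ {us'} → Duplicate x us us' → DuplicateSplit us ws (us' ++ ws)

    Duplicate-++⁻ : ∀ us ws {ys} → Duplicate x (us ++ ws) ys → DuplicateSplit us ws ys
    Duplicate-++⁻ []       ws d           = inRight d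
    Duplicate-++⁻ (_ ∷ us) ws (here _)    = inLeft (here us)
    Duplicate-++⁻ (u ∷ us) ws (there _ d) with Duplicate-++⁻ us ws d
    ... | inRight d' = inRight d'
    ... | inLeft d'  = inLeft (there u d')

    ∈-Duplicate : ∀ {xs ys} {y : A} → Duplicate x xs ys → y ∈L xs → y ∈L ys
    ∈-Duplicate (here _)    (here p)  = here p
    ∈-Duplicate (here _)    (there p) = there (there p)
    ∈-Duplicate (there _ _) (here p)  = here p
    ∈-Duplicate (there _ d) (there p) = there (∈-Duplicate d p)

    merge : ∀ {xs ys} → Duplicate x xs ys → Fin (length ys) → Fin (length xs)
    merge (here _)    zero    = zero
    merge (here _)    (suc i) = i
    merge (there _ _) zero    = zero
    merge (there _ d) (suc i) = suc (merge d i)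

    merge-mono : ∀ {xs ys} (d : Duplicate x xs ys) → merge d Preserves _≤_ ⟶ _≤_
    merge-mono (here _)    {zero}          _       = z≤n
    merge-mono (here _)    {suc i} {suc j} (s≤s p) = p
    merge-mono (there _ _) {zero}          _       = z≤n
    merge-mono (there _ d) {suc i} {suc j} (s≤s p) = s≤s (merge-mono d p)

    lookup-merge : ∀ {xs ys} (d : Duplicate x xs ys) i → lookup ys i ≡ lookup xs (merge d i)
    lookup-merge (here _)    zero    = refl
    lookup-merge (here _)    (suc i) = refl
    lookup-merge (there _ _) zero    = refl
    lookup-merge (there _ d) (suc i) = lookup-merge d i

module _ {n : ℕ} (H : Graph n) where

  IOrdering-reindex : ∀ {L L'} (g : Fin (length L') → Fin (length L)) →
                      g Preserves _≤_ ⟶ _≤_ → (∀ i → lookup L' i ≡ lookup L (g i)) →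
                      (∀ {Q} → Q ∈L L → Q ∈L L') → IOrdering H L → IOrdering H L'
  IOrdering-reindex {L} {L'} g mono lookup-g ⊆L' io = record
    { cliques     = λ Q q → cliques Q (subst (_∈L L) (lookup-index-g q) (∈-lookup (g (index q))))
    ; hasMaximal  = λ Q m → ⊆L' (hasMaximal Q m)
    ; consecutive = λ v i j k i≤j j≤k vi vk →
        subst (v ∈_) (sym (lookup-g j))
          (consecutive v (g i) (g j) (g k) (mono i≤j) (mono j≤k)
            (subst (v ∈_) (lookup-g i) vi) (subst (v ∈_) (lookup-g k) vk))
    }
    where
      open IOrdering io

      lookup-index-g : ∀ {Q} (q : Q ∈L L') → lookup L (g (index q)) ≡ Q
      lookup-index-g q = subst (_≡ _) (lookup-g (index q)) (sym (lookup-index q))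

  IOrdering-Duplicate : ∀ {X L L'} → Duplicate X L L' → IOrdering H L → IOrdering H L'
  IOrdering-Duplicate d =
    IOrdering-reindex (merge d) (merge-mono d) (lookup-merge d) (∈-Duplicate d)

  headOr∅-Duplicate : ∀ {X L L'} → Duplicate X L L' → headOr∅ H L' ≡ headOr∅ H L
  headOr∅-Duplicate (here _)    = refl
  headOr∅-Duplicate (there _ _) = refl

  lastOr∅-Duplicate : ∀ {X L L'} → Duplicate X L L' → lastOr∅ H L' ≡ lastOr∅ H L
  lastOr∅-Duplicate (here _)               = refl
  lastOr∅-Duplicate (there _ (here _))     = refl
  lastOr∅-Duplicate (there _ (there z d))  = lastOr∅-Duplicate (there z d)

  insert-between : ∀ as bs {P R} Q' → lastOr∅ H as ≡ P → headOr∅ H bs ≡ R →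
                   IsClique H Q' → (P ∩ R) ⊆ Q' → (Q' ⊆ P ⊎ Q' ⊆ R) →
                   SubcliqueInsertion H (as ++ bs) (as ++ Q' ∷ bs)
  insert-between as bs Q' refl refl = insert as bs Q'

  insertion-Duplicate : ∀ {X L L'} → IsClique H X → Duplicate X L L' → SubcliqueInsertion H L L'
  insertion-Duplicate {X} X-clique d with Duplicate⇒++ d
  ... | us , ws , refl , refl = insert us (X ∷ ws) X X-clique (p∩q⊆q _ X) (inj₂ ⊆-refl)

  -- The duplicate lies wholly on one side of the insertion point, so the
  -- neighbours of the inserted clique are unchanged.
  insertion-lifts : ∀ {X L L' M} → Duplicate X L L' → SubcliqueInsertion H L M →
                    ∃[ M' ] (Duplicate X M M' × SubcliqueInsertion H L' M')
  insertion-lifts d (insert as bs Q' Q'-clique ∩⊆Q' Q'⊆) with Duplicate-++⁻ as bs d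
  ... | inRight {bs'} d' =
        as ++ Q' ∷ bs' , Duplicate-++⁺ˡ as (there Q' d') ,
        insert-between as bs' Q' refl (headOr∅-Duplicate d') Q'-clique ∩⊆Q' Q'⊆
  ... | inLeft {as'} d' =
        as' ++ Q' ∷ bs , Duplicate-++⁺ʳ (Q' ∷ bs) d' ,
        insert-between as' bs Q' (lastOr∅-Duplicate d') refl Q'-clique ∩⊆Q' Q'⊆

  extension-lifts : ∀ {X L L' M} → Duplicate X L L' → Extends H L M →
                    ∃[ M' ] (Duplicate X M M' × Extends H L' M')
  extension-lifts d ε = _ , d , ε
  extension-lifts d (s ◅ ss) with insertion-lifts d s
  ... | _ , d' , s' with extension-lifts d' ss
  ...   | M' , d'' , ss' = M' , d'' , s' ◅ ss'

lemma4 : ∀ {n : ℕ} (H : Graph n) (as bs : List (Subset n)) (X : Subset n) →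
         IOrdering H (as ++ X ∷ X ∷ bs) →
         Equivalent H (as ++ X ∷ X ∷ bs) (as ++ X ∷ bs)
lemma4 H as bs X io L'' _ = mk⇔ shorten lengthen
  where
    d : Duplicate X (as ++ X ∷ bs) (as ++ X ∷ X ∷ bs)
    d = duplicate-at as bs

    X-clique : IsClique H X
    X-clique = IOrdering.cliques io X (∈-++⁺ʳ as (here refl))

    shorten : Compatible H (as ++ X ∷ X ∷ bs) L'' → Compatible H (as ++ X ∷ bs) L''
    shorten (J , J-io , ext , ext'') = J , J-io , insertion-Duplicate H X-clique d ◅ ext , ext''

    lengthen : Compatible H (as ++ X ∷ bs) L'' → Compatible H (as ++ X ∷ X ∷ bs) L''
    lengthen (J , J-io , ext , ext'') with extension-lifts H d ext
    ... | J' , dJ , ext' =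
          J' , IOrdering-Duplicate H dJ J-io , ext' ,
          ext'' ◅◅ insertion-Duplicate H X-clique dJ ◅ ε
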